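{- Let $k\geq 3$ be an integer and let \[ A=\{0,1\}\cup\{3,4,\ldots,k-1\}\cup\{k+2\}\subseteq \mathbb{Z}_{2k}. \] Then $A-\complement A=\mathbb{Z}_{2k}\setminus\{0\}$. Moreover, for every $v\in\mathbb{Z}_{2k}^{\times}$, if $A+v.\complement A\neq\mathbb{Z}_{2k}$, then there exists $u\in\mathbb{Z}_{2k}$ such that $v.\complement A=u-\complement A$.
   Context: $\mathbb{Z}_{2k}^{\times}$ is the group of units of $\mathbb{Z}_{2k}$; $\complement A=\mathbb{Z}_{2k}\setminus A$; for $v\in\mathbb{Z}_{2k}$ and $U\subseteq\mathbb{Z}_{2k}$, $v.U=\{vx:x\in U\}$; $U\pm V=\{x\pm y:x\in U,y\in V\}$; for $u\in\mathbb{Z}_{2k}$, $u-U=\{u-x:x\in U\}$. -}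

module Defs where

open import Data.Nat using (ℕ; zero; suc; _+_; _*_; _∸_; _≤_; _<_; NonZero)
open import Data.Nat.DivMod using (_%_; m%n<n)
open import Data.Fin using (Fin; toℕ; fromℕ<)
open import Data.Product using (Σ; ∃; ∃-syntax; _×_; _,_)
open import Data.Sum using (_⊎_)
open import Relation.Binary.PropositionalEquality using (_≡_)
open import Relation.Nullary using (¬_)
open import Level using (0ℓ)
open import Relation.Unary using (Pred)

-- ℤ_n is modelled as Fin n, with arithmetic mod n (n nonzero).
module Zmod (n : ℕ) .{{_ : NonZero n}} where

  Zn : Set
  Zn = Fin n

  ⟦_⟧ : ℕ → Zn
  ⟦ m ⟧ = fromℕ< (m%n<n m n)

  _⊕_ : Zn → Zn → Zn
  x ⊕ y = ⟦ toℕ x + toℕ y ⟧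

  _⊗_ : Zn → Zn → Zn
  x ⊗ y = ⟦ toℕ x * toℕ y ⟧

  _⊖_ : Zn → Zn → Zn
  x ⊖ y = ⟦ toℕ x + (n ∸ toℕ y) ⟧

  Subset : Set₁
  Subset = Pred Zn 0ℓ

  ∁ : Subset → Subset
  ∁ A x = ¬ A x

  _+ˢ_ : Subset → Subset → Subset
  (U +ˢ V) z = ∃[ x ] ∃[ y ] (U x × V y × z ≡ x ⊕ y)

  _-ˢ_ : Subset → Subset → Subset
  (U -ˢ V) z = ∃[ x ] ∃[ y ] (U x × V y × z ≡ x ⊖ y)

  _·ˢ_ : Zn → Subset → Subset
  (v ·ˢ U) z = ∃[ x ] (U x × z ≡ v ⊗ x)

  _−ᵖ_ : Zn → Subset → Subset
  (u −ᵖ U) z = ∃[ x ] (U x × z ≡ u ⊖ x)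

  Univ : Subset
  Univ _ = Data.Unit.⊤ where import Data.Unit

  NonZeroElts : Subset
  NonZeroElts z = ¬ (toℕ z ≡ 0)

  _≐_ : Subset → Subset → Set
  U ≐ V = ∀ z → (U z → V z) × (V z → U z)

  Unit : Zn → Set
  Unit v = ∃[ w ] (v ⊗ w ≡ ⟦ 1 ⟧)

-- The set A = {0,1} ∪ {3,…,k-1} ∪ {k+2} ⊆ ℤ_{2k}, as a predicate on Fin (2k)
-- (elements identified with their representatives 0 … 2k-1).
Aset : (k : ℕ) → Fin (2 * k) → Set
Aset k x = (toℕ x ≡ 0) ⊎ (toℕ x ≡ 1) ⊎ (3 ≤ toℕ x × toℕ x ≤ k ∸ 1) ⊎ (toℕ x ≡ k + 2)

nonZero2k : (k : ℕ) → 3 ≤ k → NonZero (2 * k)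
nonZero2k (suc k) _ = _

module Submission where

-- Both parts reduce to one fact about arithmetic progressions in A.  If z ≠ 0
-- and a − z ∈ A for every a ∈ A, then 0, −z, −2z, … all lie in A.  If w = v⁻¹
-- and w(z − a) ∈ A for every a ∈ A, then w(z−3), w(z−4), …, w(z−k+1) lie in A,
-- a progression with step −w.  The key lemma: for k ≥ 8, A contains no
-- progression of length k − 3 whose step s satisfies 3 ≤ s ≤ 2k − 3.  Steps
-- s ≤ k − 3 cannot wrap around, so the terms grow past k − 1; steps near k
-- push every block of A into the next one and finally out of A; a step s > k
-- is the step 2k − s read backwards.  The remaining steps are ±1, ±2: ±2 is
-- never a unit (2k is even), w = −1 gives v = −1 and u = 0, and step −1 pins
-- the progression to k−1, …, 3, after which a = 1 gives w(z − 1) = k + 1 ∉ A.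

open import Defs
open import Data.Nat
open import Data.Nat.Properties
open import Data.Nat.DivMod
open import Data.Nat.Tactic.RingSolver using (solve)
open import Data.List using (_∷_; [])
open import Data.Product using (∃; ∃-syntax; _×_; _,_; proj₁; proj₂; map₂)
open import Data.Sum using (_⊎_; inj₁; inj₂)
open import Data.Empty using (⊥; ⊥-elim)
open import Data.Unit using (tt)
open import Function using (case_of_; _∘_)
open import Relation.Nullary
open import Relation.Nullary.Decidable using (_×-dec_; _⊎-dec_; ¬?; _→-dec_; decidable-stable; True; toWitness)
open import Relation.Binary.PropositionalEquality
open import Data.Fin as F using (toℕ)
open import Data.Fin.Properties using (toℕ-fromℕ<; toℕ-injective; toℕ<n; any?; all?)

-- An inequality witnessed by an explicit difference; with the ring solver this
-- settles the concrete bounds in terms of k = 8 + m used below.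
≤-by : ∀ {a b} d → a + d ≡ b → a ≤ b
≤-by {a} d e = ≤-trans (m≤m+n a d) (≤-reflexive e)

-- Congruence of natural numbers modulo N.  It is a data type (rather than the
-- bare equation) so that both sides can be inferred from a proof.
module ModArith (N : ℕ) .{{_ : NonZero N}} where

  infix 4 _≈_
  data _≈_ (a b : ℕ) : Set where
    ≈i : a % N ≡ b % N → a ≈ b

  ≈⇒%≡ : ∀ {a b} → a ≈ b → a % N ≡ b % N
  ≈⇒%≡ (≈i p) = p

  ≈-refl : ∀ {a} → a ≈ a
  ≈-refl = ≈i refl

  ≈-sym : ∀ {a b} → a ≈ b → b ≈ a
  ≈-sym (≈i p) = ≈i (sym p)

  ≈-trans : ∀ {a b c} → a ≈ b → b ≈ c → a ≈ c
  ≈-trans (≈i p) (≈i q) = ≈i (trans p q)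

  ≡⇒≈ : ∀ {a b} → a ≡ b → a ≈ b
  ≡⇒≈ refl = ≈-refl

  ≈-+ : ∀ {a b c d} → a ≈ b → c ≈ d → a + c ≈ b + d
  ≈-+ {a} {b} {c} {d} (≈i p) (≈i q) =
    ≈i (trans (%-distribˡ-+ a c N) (trans (cong₂ (λ x y → (x + y) % N) p q) (sym (%-distribˡ-+ b d N))))

  ≈-* : ∀ {a b c d} → a ≈ b → c ≈ d → a * c ≈ b * d
  ≈-* {a} {b} {c} {d} (≈i p) (≈i q) =
    ≈i (trans (%-distribˡ-* a c N) (trans (cong₂ (λ x y → (x * y) % N) p q) (sym (%-distribˡ-* b d N))))

  %-≈ : ∀ a → a % N ≈ a
  %-≈ a = ≈i (m%n%n≡m%n a N)

  +N-≈ : ∀ a → a + N ≈ a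
  +N-≈ a = ≈i ([m+n]%n≡m%n a N)

  N≈0 : N ≈ 0
  N≈0 = +N-≈ 0

  *N≈0 : ∀ a → a * N ≈ 0
  *N≈0 a = ≈i (trans (m*n%n≡0 a N) (sym (m<n⇒m%n≡m (>-nonZero⁻¹ N))))

  ∸-inverse : ∀ x → x ≤ N → (N ∸ x) + x ≈ 0
  ∸-inverse x x≤N = ≈-trans (≡⇒≈ (m∸n+n≡m x≤N)) N≈0

  -- addition is cancellative: add an inverse u of t on both sides
  ≈-cancelʳ-+ : ∀ {a b} t → a + t ≈ b + t → a ≈ b
  ≈-cancelʳ-+ {a} {b} t p = ≈-trans (≈-sym (t+u-vanishes a)) (≈-trans (≈-+ p ≈-refl) (t+u-vanishes b))
    where
      u = N ∸ t % N
      t+u≈0 : t + u ≈ 0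
      t+u≈0 = ≈-trans (≈-+ (≈-sym (%-≈ t)) ≈-refl) (≈-trans (≡⇒≈ (m+[n∸m]≡n (m%n≤n t N))) N≈0)
      t+u-vanishes : ∀ x → x + t + u ≈ x
      t+u-vanishes x = ≈-trans (≡⇒≈ (+-assoc x t u)) (≈-trans (≈-+ (≈-refl {x}) t+u≈0) (≡⇒≈ (+-identityʳ x)))

  inverse-unique : ∀ {a b} t → a + t ≈ 0 → b + t ≈ 0 → a ≈ b
  inverse-unique t p q = ≈-cancelʳ-+ t (≈-trans p (≈-sym q))

  ≈⇒≡ : ∀ {a b} → a < N → b < N → a ≈ b → a ≡ b
  ≈⇒≡ a<N b<N (≈i p) = trans (sym (m<n⇒m%n≡m a<N)) (trans p (m<n⇒m%n≡m b<N))

module ZnFacts (N : ℕ) .{{_ : NonZero N}} where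
  open Zmod N
  open ModArith N

  toℕ-⟦⟧ : ∀ a → toℕ ⟦ a ⟧ ≡ a % N
  toℕ-⟦⟧ a = toℕ-fromℕ< _

  ⟦⟧-≈ : ∀ a → toℕ ⟦ a ⟧ ≈ a
  ⟦⟧-≈ a = ≈-trans (≡⇒≈ (toℕ-⟦⟧ a)) (%-≈ a)

  ⟦⟧-small : ∀ {a} → a < N → toℕ ⟦ a ⟧ ≡ a
  ⟦⟧-small {a} a<N = trans (toℕ-⟦⟧ a) (m<n⇒m%n≡m a<N)

  toℕ-≈-injective : ∀ {x y : Zn} → toℕ x ≈ toℕ y → x ≡ y
  toℕ-≈-injective {x} {y} p = toℕ-injective (≈⇒≡ (toℕ<n x) (toℕ<n y) p)

  toℕ≤N : ∀ (x : Zn) → toℕ x ≤ N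
  toℕ≤N x = <⇒≤ (toℕ<n x)

  ⊕-≈ : ∀ (x y : Zn) → toℕ (x ⊕ y) ≈ toℕ x + toℕ y
  ⊕-≈ x y = ⟦⟧-≈ _

  ⊗-≈ : ∀ (x y : Zn) → toℕ (x ⊗ y) ≈ toℕ x * toℕ y
  ⊗-≈ x y = ⟦⟧-≈ _

  ⊖-≈ : ∀ (x y : Zn) → toℕ (x ⊖ y) ≈ toℕ x + (N ∸ toℕ y)
  ⊖-≈ x y = ⟦⟧-≈ _

  ∸-cancel : ∀ x (y : Zn) → x + (N ∸ toℕ y) + toℕ y ≈ x
  ∸-cancel x y = ≈-trans (≡⇒≈ (trans (+-assoc x _ (toℕ y)) (cong (x +_) (m∸n+n≡m (toℕ≤N y))))) (+N-≈ x)

  ⊖-⊖-cancel : ∀ (a z : Zn) → a ⊖ (a ⊖ z) ≡ z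
  ⊖-⊖-cancel a z = toℕ-≈-injective (≈-sym (≈-cancelʳ-+ (toℕ (a ⊖ z)) (≈-trans z+c≈a (≈-sym a-c+c≈a))))
    where
      a-c+c≈a : toℕ (a ⊖ (a ⊖ z)) + toℕ (a ⊖ z) ≈ toℕ a
      a-c+c≈a = ≈-trans (≈-+ (⊖-≈ a (a ⊖ z)) ≈-refl) (∸-cancel (toℕ a) (a ⊖ z))
      z+c≈a : toℕ z + toℕ (a ⊖ z) ≈ toℕ a
      z+c≈a = ≈-trans (≈-+ (≈-refl {toℕ z}) (⊖-≈ a z))
                (≈-trans (≡⇒≈ (+-comm (toℕ z) _)) (∸-cancel (toℕ a) z))

  ⊖≡0⇒≡ : ∀ (a c : Zn) → toℕ (a ⊖ c) ≡ 0 → a ≡ c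
  ⊖≡0⇒≡ a c e = toℕ-≈-injective (inverse-unique (N ∸ toℕ c)
      (≈-trans (≈-sym (⊖-≈ a c)) (≡⇒≈ e))
      (≈-trans (≡⇒≈ (+-comm (toℕ c) (N ∸ toℕ c))) (∸-inverse (toℕ c) (toℕ≤N c))))

  unit⇒≈1 : ∀ (v w : Zn) → v ⊗ w ≡ ⟦ 1 ⟧ → toℕ v * toℕ w ≈ 1
  unit⇒≈1 v w e = ≈-trans (≈-sym (⊗-≈ v w)) (≈-trans (≡⇒≈ (cong toℕ e)) (⟦⟧-≈ 1))

  unit-decompose : ∀ (v w z a : Zn) → toℕ v * toℕ w ≈ 1 → z ≡ a ⊕ (v ⊗ (w ⊗ (z ⊖ a)))
  unit-decompose v w z a vw≈1 =
    toℕ-≈-injective (≈-sym (≈-trans (⊕-≈ a _) (≈-trans (≈-+ (≈-refl {A}) vw[z-a]≈z-a) a+[z-a]≈z)))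
    where
      A = toℕ a
      Z = toℕ z
      V = toℕ v
      W = toℕ w
      vw[z-a]≈z-a : toℕ (v ⊗ (w ⊗ (z ⊖ a))) ≈ Z + (N ∸ A)
      vw[z-a]≈z-a =
        ≈-trans (⊗-≈ v _) (≈-trans (≈-* (≈-refl {V}) (≈-trans (⊗-≈ w _) (≈-* (≈-refl {W}) (⊖-≈ z a))))
          (≈-trans (≡⇒≈ (sym (*-assoc V W (Z + (N ∸ A))))) (≈-trans (≈-* vw≈1 (≈-refl {Z + (N ∸ A)})) (≡⇒≈ (+-identityʳ _)))))
      a+[z-a]≈z : A + (Z + (N ∸ A)) ≈ Z
      a+[z-a]≈z = ≈-trans (≡⇒≈ (trans (sym (+-assoc A Z (N ∸ A))) (cong (_+ (N ∸ A)) (+-comm A Z))))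
                    (≈-trans (≡⇒≈ (+-assoc Z A (N ∸ A))) (≈-trans (≡⇒≈ (cong (Z +_) (m+[n∸m]≡n (toℕ≤N a)))) (+N-≈ Z)))

  inverse-of-minus-one : ∀ (v w : Zn) → toℕ w ≡ N ∸ 1 → toℕ v * toℕ w ≈ 1 → ∀ x → v ⊗ x ≡ ⟦ 0 ⟧ ⊖ x
  inverse-of-minus-one v w w≡-1 vw≈1 x =
    toℕ-≈-injective (≈-trans (⊗-≈ v x) (≈-trans vx≈-x (≈-sym (≈-trans (⊖-≈ ⟦ 0 ⟧ x) (≈-+ (⟦⟧-≈ 0) (≈-refl {N ∸ X}))))))
    where
      V = toℕ v
      W = toℕ w
      X = toℕ x
      1+W≡N : suc W ≡ N
      1+W≡N = trans (cong suc w≡-1) (trans (+-comm 1 (N ∸ 1)) (m∸n+n≡m (≤-trans (s≤s z≤n) (toℕ<n v))))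
      v+1≈0 : V + 1 ≈ 0
      v+1≈0 = ≈-trans (≡⇒≈ (+-comm V 1)) (≈-trans (≈-sym (≈-+ vw≈1 (≈-refl {V})))
                (≈-trans (≡⇒≈ (trans (+-comm (V * W) V) (trans (sym (*-suc V W)) (cong (V *_) 1+W≡N)))) (*N≈0 V)))
      vx≈-x : V * X ≈ N ∸ X
      vx≈-x = inverse-unique X
                (≈-trans (≡⇒≈ (trans (cong (V * X +_) (sym (*-identityˡ X))) (sym (*-distribʳ-+ X V 1)))) (≈-* v+1≈0 (≈-refl {X})))
                (∸-inverse X (toℕ≤N x))

  w⊗[z⊖a]-≈ : ∀ (w z : Zn) a → a < N → toℕ (w ⊗ (z ⊖ ⟦ a ⟧)) ≈ toℕ w * (toℕ z + (N ∸ a))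
  w⊗[z⊖a]-≈ w z a a<N = ≈-trans (⊗-≈ w _) (≈-* (≈-refl {toℕ w})
                          (≈-trans (⊖-≈ z ⟦ a ⟧) (≡⇒≈ (cong (λ t → toℕ z + (N ∸ t)) (⟦⟧-small a<N)))))

  -- as a runs through a, a+1, a+2, …, the values w·(z − a) form a progression of step −w
  w⊗[z⊖a]-step : ∀ (w z : Zn) a → suc a < N →
                 toℕ (w ⊗ (z ⊖ ⟦ suc a ⟧)) ≡ (toℕ (w ⊗ (z ⊖ ⟦ a ⟧)) + (N ∸ toℕ w)) % N
  w⊗[z⊖a]-step w z a 1+a<N = ≈⇒≡ (toℕ<n _) (m%n<n _ N) (≈-trans next (≈-sym (≈-trans (%-≈ _) previous+[-w])))
    where
      W = toℕ w
      Z = toℕ z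
      D = N ∸ suc a
      next : toℕ (w ⊗ (z ⊖ ⟦ suc a ⟧)) ≈ W * (Z + D)
      next = w⊗[z⊖a]-≈ w z (suc a) 1+a<N
      N∸a≡1+D : N ∸ a ≡ suc D
      N∸a≡1+D = +-∸-assoc 1 (<⇒≤ 1+a<N)
      previous+[-w] : toℕ (w ⊗ (z ⊖ ⟦ a ⟧)) + (N ∸ W) ≈ W * (Z + D)
      previous+[-w] = ≈-trans (≈-+ (w⊗[z⊖a]-≈ w z a (<-trans (n<1+n a) 1+a<N)) (≈-refl {N ∸ W}))
          (≈-trans (≡⇒≈ (begin
              W * (Z + (N ∸ a)) + (N ∸ W)   ≡⟨ cong (λ t → W * (Z + t) + (N ∸ W)) N∸a≡1+D ⟩
              W * (Z + suc D) + (N ∸ W)     ≡⟨ cong (λ t → W * t + (N ∸ W)) (+-suc Z D) ⟩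
              W * suc (Z + D) + (N ∸ W)     ≡⟨ cong (_+ (N ∸ W)) (*-suc W (Z + D)) ⟩
              W + W * (Z + D) + (N ∸ W)     ≡⟨ cong (_+ (N ∸ W)) (+-comm W (W * (Z + D))) ⟩
              W * (Z + D) + W + (N ∸ W)     ≡⟨ +-assoc (W * (Z + D)) W (N ∸ W) ⟩
              W * (Z + D) + (W + (N ∸ W))   ≡⟨ cong (W * (Z + D) +_) (m+[n∸m]≡n (toℕ≤N w)) ⟩
              W * (Z + D) + N               ∎)) (+N-≈ _))
        where open ≡-Reasoning

InA : ℕ → ℕ → Set
InA k y = (y ≡ 0) ⊎ (y ≡ 1) ⊎ (3 ≤ y × y ≤ k ∸ 1) ⊎ (y ≡ k + 2)

inA? : ∀ k y → Dec (InA k y)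
inA? k y = (y ≟ 0) ⊎-dec ((y ≟ 1) ⊎-dec (((3 ≤? y) ×-dec (y ≤? k ∸ 1)) ⊎-dec (y ≟ k + 2)))

module Reduction (k : ℕ) .{{_ : NonZero (2 * k)}} where
  open Zmod (2 * k)
  open ZnFacts (2 * k)

  Aset? : ∀ (x : Zn) → Dec (Aset k x)
  Aset? x = inA? k (toℕ x)

  -- A is finite and decidable, so a map under which A is not closed moves
  -- an explicit element of A out of A
  escape : (f : Zn → Zn) → ¬ (∀ a → Aset k a → Aset k (f a)) → ∃ λ a → Aset k a × ¬ Aset k (f a)
  escape f not-closed with any? (λ a → Aset? a ×-dec ¬? (Aset? (f a)))
  ... | yes found = found
  ... | no none = ⊥-elim (not-closed (λ a a∈A → decidable-stable (Aset? (f a)) (λ f[a]∉A → none (a , a∈A , f[a]∉A))))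

  Differences : Set
  Differences = ∀ z → NonZeroElts z → ∃ λ a → Aset k a × ¬ Aset k (a ⊖ z)

  -- for w = v⁻¹: every z moves some a ∈ A out of A under a ↦ w(z − a),
  -- which makes A + v·∁A everything
  Covering : Zn → Set
  Covering w = ∀ z → ∃ λ a → Aset k a × ¬ Aset k (w ⊗ (z ⊖ a))

  Reflected : Zn → Set
  Reflected v = ∃[ u ] ((v ·ˢ ∁ (Aset k)) ≐ (u −ᵖ ∁ (Aset k)))

  Dichotomy : Set
  Dichotomy = ∀ v w → v ⊗ w ≡ ⟦ 1 ⟧ → Covering w ⊎ Reflected v

  part1 : Differences → (Aset k -ˢ ∁ (Aset k)) ≐ NonZeroElts
  part1 differences z = nonzero , difference
    where
      nonzero : (Aset k -ˢ ∁ (Aset k)) z → NonZeroElts z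
      nonzero (a , c , a∈A , c∉A , z≡a-c) z≡0 = c∉A (subst (Aset k) (⊖≡0⇒≡ a c (trans (cong toℕ (sym z≡a-c)) z≡0)) a∈A)
      difference : NonZeroElts z → (Aset k -ˢ ∁ (Aset k)) z
      difference z≢0 with differences z z≢0
      ... | a , a∈A , a-z∉A = a , (a ⊖ z) , a∈A , a-z∉A , sym (⊖-⊖-cancel a z)

  part2 : Dichotomy → ∀ v → Unit v → ¬ ((Aset k +ˢ (v ·ˢ ∁ (Aset k))) ≐ Univ) → Reflected v
  part2 dichotomy v (w , vw≡1) not-everything with dichotomy v w vw≡1
  ... | inj₂ reflected = reflected
  ... | inj₁ covering = ⊥-elim (not-everything (λ z → (λ _ → tt) , (λ _ → decomposition z (covering z))))
    where
      decomposition : ∀ z → (∃ λ a → Aset k a × ¬ Aset k (w ⊗ (z ⊖ a))) → (Aset k +ˢ (v ·ˢ ∁ (Aset k))) z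
      decomposition z (a , a∈A , c∉A) = a , (v ⊗ (w ⊗ (z ⊖ a))) , a∈A , ((w ⊗ (z ⊖ a)) , c∉A , refl)
                            , unit-decompose v w z a (unit⇒≈1 v w vw≡1)

  -- for a concrete k both hypotheses are decidable by exhaustive search
  differences? : Dec Differences
  differences? = all? (λ z → ¬? (toℕ z ≟ 0) →-dec any? (λ a → Aset? a ×-dec ¬? (Aset? (a ⊖ z))))

  covering? : ∀ w → Dec (Covering w)
  covering? w = all? (λ z → any? (λ a → Aset? a ×-dec ¬? (Aset? (w ⊗ (z ⊖ a)))))

  reflected? : ∀ v → Dec (Reflected v)
  reflected? v = any? (λ u → all? (λ z → (in-v∁A? z →-dec in-u-∁A? u z) ×-dec (in-u-∁A? u z →-dec in-v∁A? z)))
    where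
      in-v∁A? : ∀ z → Dec ((v ·ˢ ∁ (Aset k)) z)
      in-v∁A? z = any? (λ x → ¬? (Aset? x) ×-dec (z F.≟ v ⊗ x))
      in-u-∁A? : ∀ u z → Dec ((u −ᵖ ∁ (Aset k)) z)
      in-u-∁A? u z = any? (λ x → ¬? (Aset? x) ×-dec (z F.≟ u ⊖ x))

  dichotomy? : Dec Dichotomy
  dichotomy? = all? (λ v → all? (λ w → (v ⊗ w F.≟ ⟦ 1 ⟧) →-dec (covering? w ⊎-dec reflected? v)))

  decide : True (differences? ×-dec dichotomy?) → Differences × Dichotomy
  decide = toWitness

module Large (m : ℕ) where
  k : ℕ
  k = 8 + m

  n : ℕ
  n = 2 * k

  open ModArith n

  shift : ℕ → ℕ → ℕ
  shift s y = (y + s) % n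

  small : ∀ {a} → a < n → a % n ≡ a
  small = m<n⇒m%n≡m

  shift-small : ∀ s y → y + s < n → shift s y ≡ y + s
  shift-small s y = small

  inA-split : ∀ {y} → InA k y → y ≤ k ∸ 1 ⊎ y ≡ k + 2
  inA-split (inj₁ refl) = inj₁ z≤n
  inA-split (inj₂ (inj₁ refl)) = inj₁ (s≤s z≤n)
  inA-split (inj₂ (inj₂ (inj₁ (_ , y≤k-1)))) = inj₁ y≤k-1
  inA-split (inj₂ (inj₂ (inj₂ y≡k+2))) = inj₂ y≡k+2

  inA-≤ : ∀ {y} → InA k y → y ≤ k + 2
  inA-≤ y∈A with inA-split y∈A
  ... | inj₁ y≤k-1 = ≤-trans y≤k-1 (≤-by {7 + m} {8 + m + 2} 3 (solve (m ∷ [])))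
  ... | inj₂ refl = ≤-refl

  inA-< : ∀ {y} → InA k y → y < n
  inA-< y∈A = ≤-trans (s≤s (inA-≤ y∈A)) (≤-by {suc (8 + m + 2)} {2 * (8 + m)} (5 + m) (solve (m ∷ [])))

  ∉A-gap : ∀ {x} → k ≤ x → x ≢ k + 2 → ¬ InA k x
  ∉A-gap k≤x _ (inj₁ refl) = case k≤x of λ ()
  ∉A-gap k≤x _ (inj₂ (inj₁ refl)) = case k≤x of λ { (s≤s ()) }
  ∉A-gap k≤x _ (inj₂ (inj₂ (inj₁ (_ , x≤k-1)))) = <-irrefl refl (≤-trans k≤x x≤k-1)
  ∉A-gap _ x≢k+2 (inj₂ (inj₂ (inj₂ x≡k+2))) = x≢k+2 x≡k+2

  ∉A-above : ∀ {x} → k + 2 < x → ¬ InA k x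
  ∉A-above k+2<x = ∉A-gap (≤-trans (≤-by 2 refl) (<⇒≤ k+2<x)) (λ x≡k+2 → <-irrefl (sym x≡k+2) k+2<x)

  ∉A-k+1 : ¬ InA k (k + 1)
  ∉A-k+1 = ∉A-gap (≤-by 1 refl) (λ e → case +-cancelˡ-≡ k 1 2 e of λ ())

  ∉A-2 : ¬ InA k 2
  ∉A-2 (inj₂ (inj₂ (inj₁ (s≤s (s≤s ()) , _))))

  ∉A-n∸1 : ¬ InA k (n ∸ 1)
  ∉A-n∸1 = ∉A-above (≤-by {suc (8 + m + 2)} {7 + m + (8 + m + 0)} (4 + m) (solve (m ∷ [])))

  ∉A-n∸2 : ¬ InA k (n ∸ 2)
  ∉A-n∸2 = ∉A-above (≤-by {suc (8 + m + 2)} {6 + m + (8 + m + 0)} (3 + m) (solve (m ∷ [])))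

  len : ℕ
  len = k ∸ 3

  record Progression (s : ℕ) (y : ℕ → ℕ) : Set where
    field
      inA  : ∀ j → j < len → InA k (y j)
      step : ∀ j → suc j < len → y (suc j) ≡ shift s (y j)

    next-inA : ∀ j → suc j < len → InA k (shift s (y j))
    next-inA j p = subst (InA k) (step j p) (inA (suc j) p)

  -- Steps 3 ≤ s ≤ k − 3: nothing wraps around, so the terms increase by s ≥ 3
  -- each time and cannot all stay below k.
  module SmallStep (s : ℕ) (3≤s : 3 ≤ s) (s≤k-3 : s ≤ 5 + m) where

    no-wrap : ∀ {y} → y ≤ k + 2 → shift s y ≡ y + s
    no-wrap {y} y≤k+2 = shift-small s y (≤-trans (s≤s (+-mono-≤ y≤k+2 s≤k-3))
                             (≤-by {suc (8 + m + 2 + (5 + m))} {2 * (8 + m)} 0 (solve (m ∷ []))))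

    climb : ∀ {y} → InA k y → InA k (shift s y) → y ≤ k ∸ 1 × shift s y ≡ y + s
    climb y∈A y+s∈A with inA-split y∈A
    ... | inj₁ y≤k-1 = y≤k-1 , no-wrap (inA-≤ y∈A)
    ... | inj₂ refl = ⊥-elim (∉A-above (m<m+n (k + 2) (≤-trans (s≤s z≤n) 3≤s)) (subst (InA k) (no-wrap ≤-refl) y+s∈A))

    no-progression : ∀ {y} → ¬ Progression s y
    no-progression {y} P = <-irrefl refl (≤-trans 8+m≤3*[3+m] (≤-trans (grows (3 + m) ≤-refl) (proj₁ (climbs (3 + m) ≤-refl))))
      where
        open Progression P
        climbs : ∀ j → suc j < len → y j ≤ k ∸ 1 × y (suc j) ≡ y j + s
        climbs j p = map₂ (trans (step j p)) (climb (inA j (<-trans (n<1+n j) p)) (next-inA j p))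
        grows : ∀ j → suc j < len → 3 * j ≤ y j
        grows zero _ = z≤n
        grows (suc j) p = begin
            3 * suc j   ≡⟨ *-suc 3 j ⟩
            3 + 3 * j   ≤⟨ +-mono-≤ 3≤s (grows j q) ⟩
            s + y j     ≡⟨ +-comm s (y j) ⟩
            y j + s     ≡⟨ sym (proj₂ (climbs j q)) ⟩
            y (suc j)   ∎
          where
            open ≤-Reasoning
            q = <-trans (n<1+n (suc j)) p
        8+m≤3*[3+m] : 8 + m ≤ 3 * (3 + m)
        8+m≤3*[3+m] = ≤-by (1 + (m + m)) (solve (m ∷ []))

  -- Translation by s sends
  -- mid → top → low → high → outside A, so no run of 5 terms stays in A.
  module MidStep (s : ℕ) (k-2≤s : 6 + m ≤ s) (s≤k : s ≤ 8 + m) where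

    data Block (y : ℕ) : Set where
      low  : y ≤ 1 → Block y
      mid  : 3 ≤ y → y ≤ 5 + m → Block y
      high : 6 + m ≤ y → y ≤ 7 + m → Block y
      top  : y ≡ k + 2 → Block y

    block : ∀ {y} → InA k y → Block y
    block (inj₁ refl) = low z≤n
    block (inj₂ (inj₁ refl)) = low (s≤s z≤n)
    block {y} (inj₂ (inj₂ (inj₁ (3≤y , y≤k-1)))) with y ≤? 5 + m
    ... | yes y≤k-3 = mid 3≤y y≤k-3
    ... | no y≰k-3 = high (≰⇒> y≰k-3) y≤k-1
    block (inj₂ (inj₂ (inj₂ y≡k+2))) = top y≡k+2

    high↦out : ∀ {y} → 6 + m ≤ y → y ≤ 7 + m → ¬ InA k (shift s y)
    high↦out {y} k-2≤y y≤k-1 = ∉A-above k+2<y+s ∘ subst (InA k) no-wrap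
      where
        no-wrap : shift s y ≡ y + s
        no-wrap = shift-small s y (≤-trans (s≤s (+-mono-≤ y≤k-1 s≤k)) (≤-by {suc (7 + m + (8 + m))} {2 * (8 + m)} 0 (solve (m ∷ []))))
        k+2<y+s : k + 2 < y + s
        k+2<y+s = ≤-trans (≤-by {suc (8 + m + 2)} {6 + m + (6 + m)} (1 + m) (solve (m ∷ []))) (+-mono-≤ k-2≤y k-2≤s)

    low↦high : ∀ {y} → y ≤ 1 → InA k (shift s y) → 6 + m ≤ shift s y × shift s y ≤ 7 + m
    low↦high {y} y≤1 y+s∈A = case inA-split (subst (InA k) no-wrap y+s∈A) of λ where
        (inj₁ y+s≤k-1) → subst (6 + m ≤_) (sym no-wrap) (≤-trans k-2≤s (m≤n+m s y)) , subst (_≤ 7 + m) (sym no-wrap) y+s≤k-1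
        (inj₂ y+s≡k+2) → ⊥-elim (<-irrefl y+s≡k+2 (≤-trans (s≤s y+s≤k+1) (≤-by {suc (1 + (8 + m))} {8 + m + 2} 0 (solve (m ∷ [])))))
      where
        y+s≤k+1 : y + s ≤ 1 + (8 + m)
        y+s≤k+1 = +-mono-≤ y≤1 s≤k
        no-wrap : shift s y ≡ y + s
        no-wrap = shift-small s y (≤-trans (s≤s y+s≤k+1) (≤-by {suc (1 + (8 + m))} {2 * (8 + m)} (6 + m) (solve (m ∷ []))))

    -- (k + 2) + s wraps around to s − (k − 2) ∈ {0, 1, 2}
    top↦low : ∀ {y} → y ≡ k + 2 → InA k (shift s y) → shift s y ≤ 1
    top↦low refl r∈A = reduce (subst (InA k) wraps r∈A)
      where
        r = s ∸ (6 + m)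
        r≤2 : r ≤ 2
        r≤2 = ≤-trans (∸-monoˡ-≤ (6 + m) s≤k) (≤-reflexive (m+n∸n≡m 2 m))
        wraps : shift s (k + 2) ≡ r
        wraps = begin
            (k + 2 + s) % n               ≡⟨ cong (λ t → (k + 2 + t) % n) (sym (m∸n+n≡m k-2≤s)) ⟩
            (k + 2 + (r + (6 + m))) % n   ≡⟨ cong (_% n) (regroup m r) ⟩
            (r + 2 * (8 + m)) % n         ≡⟨ ≈⇒%≡ (+N-≈ r) ⟩
            r % n                         ≡⟨ small (≤-trans (s≤s r≤2) (≤-by {3} {2 * (8 + m)} (13 + (m + m)) (solve (m ∷ [])))) ⟩
            r                             ∎
          where
            open ≡-Reasoning
            regroup : ∀ m r → 8 + m + 2 + (r + (6 + m)) ≡ r + 2 * (8 + m)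
            regroup m r = solve (m ∷ r ∷ [])
        reduce : InA k r → shift s (k + 2) ≤ 1
        reduce (inj₁ r≡0) = ≤-trans (≤-reflexive (trans wraps r≡0)) z≤n
        reduce (inj₂ (inj₁ r≡1)) = ≤-reflexive (trans wraps r≡1)
        reduce (inj₂ (inj₂ (inj₁ (3≤r , _)))) = ⊥-elim (<-irrefl refl (≤-trans 3≤r r≤2))
        reduce (inj₂ (inj₂ (inj₂ r≡k+2))) = ⊥-elim (<-irrefl refl (≤-trans (≤-by {3} {8 + m + 2} (7 + m) (solve (m ∷ []))) (≤-trans (≤-reflexive (sym r≡k+2)) r≤2)))

    mid↦top : ∀ {y} → 3 ≤ y → y ≤ 5 + m → InA k (shift s y) → shift s y ≡ k + 2
    mid↦top {y} 3≤y y≤k-3 y+s∈A = case inA-split (subst (InA k) no-wrap y+s∈A) of λ where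
        (inj₁ y+s≤k-1) → ⊥-elim (<-irrefl refl (≤-trans (≤-by {8 + m} {3 + (6 + m)} 1 (solve (m ∷ []))) (≤-trans (+-mono-≤ 3≤y k-2≤s) y+s≤k-1)))
        (inj₂ y+s≡k+2) → trans no-wrap y+s≡k+2
      where
        no-wrap : shift s y ≡ y + s
        no-wrap = shift-small s y (≤-trans (s≤s (+-mono-≤ y≤k-3 s≤k)) (≤-by {suc (5 + m + (8 + m))} {2 * (8 + m)} 2 (solve (m ∷ []))))

    no-progression : ∀ {y} → ¬ Progression s y
    no-progression {y} P = from-block (block (inA 0 (s≤s z≤n)))
      where
        open Progression P
        low-exits : ∀ j → 2 + j < len → y j ≤ 1 → ⊥
        low-exits j p y≤1 = high↦out (subst (6 + m ≤_) (sym (step j q)) (proj₁ h)) (subst (_≤ 7 + m) (sym (step j q)) (proj₂ h)) (next-inA (suc j) p)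
          where
            q = <-trans (n<1+n (suc j)) p
            h = low↦high y≤1 (next-inA j q)
        top-exits : ∀ j → 3 + j < len → y j ≡ k + 2 → ⊥
        top-exits j p y≡k+2 = low-exits (suc j) p (subst (_≤ 1) (sym (step j q)) (top↦low y≡k+2 (next-inA j q)))
          where q = <-trans (n<1+n (suc j)) (<-trans (n<1+n (2 + j)) p)
        from-block : Block (y 0) → ⊥
        from-block (low y≤1) = low-exits 0 (s≤s (s≤s (s≤s z≤n))) y≤1
        from-block (mid 3≤y y≤k-3) = top-exits 1 (s≤s (s≤s (s≤s (s≤s (s≤s z≤n))))) (trans (step 0 (s≤s (s≤s z≤n))) (mid↦top 3≤y y≤k-3 (next-inA 0 (s≤s (s≤s z≤n)))))
        from-block (high k-2≤y y≤k-1) = high↦out k-2≤y y≤k-1 (next-inA 0 (s≤s (s≤s z≤n)))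
        from-block (top y≡k+2) = top-exits 0 (s≤s (s≤s (s≤s (s≤s z≤n)))) y≡k+2

  no-progression≤k : ∀ s {y} → 3 ≤ s → s ≤ k → ¬ Progression s y
  no-progression≤k s 3≤s s≤k with s ≤? 5 + m
  ... | yes s≤k-3 = SmallStep.no-progression s 3≤s s≤k-3
  ... | no s≰k-3 = MidStep.no-progression s (≰⇒> s≰k-3) s≤k

  shift-back : ∀ s {a} → a < n → s ≤ n → shift (n ∸ s) (shift s a) ≡ a
  shift-back s {a} a<n s≤n = begin
      ((a + s) % n + (n ∸ s)) % n   ≡⟨ ≈⇒%≡ (≈-+ (%-≈ (a + s)) (≈-refl {n ∸ s})) ⟩
      (a + s + (n ∸ s)) % n         ≡⟨ cong (_% n) (+-assoc a s (n ∸ s)) ⟩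
      (a + (s + (n ∸ s))) % n       ≡⟨ cong (λ t → (a + t) % n) (m+[n∸m]≡n s≤n) ⟩
      (a + n) % n                   ≡⟨ ≈⇒%≡ (+N-≈ a) ⟩
      a % n                         ≡⟨ small a<n ⟩
      a                             ∎
    where open ≡-Reasoning

  reverse : ∀ {s y} → s ≤ n → Progression s y → Progression (n ∸ s) (λ j → y (4 + m ∸ j))
  reverse {s} {y} s≤n P = record { inA = λ j _ → inA (4 + m ∸ j) (s≤s (m∸n≤m (4 + m) j)) ; step = back }
    where
      open Progression P
      back : ∀ j → suc j < len → y (3 + m ∸ j) ≡ shift (n ∸ s) (y (4 + m ∸ j))
      back j p = sym (begin
          shift (n ∸ s) (y (4 + m ∸ j))         ≡⟨ cong (shift (n ∸ s) ∘ y) (+-∸-assoc 1 j≤3+m) ⟩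
          shift (n ∸ s) (y (suc i))             ≡⟨ cong (shift (n ∸ s)) (step i 1+i<len) ⟩
          shift (n ∸ s) (shift s (y i))         ≡⟨ shift-back s (inA-< (inA i (<-trans (n<1+n i) 1+i<len))) s≤n ⟩
          y i                                   ∎)
        where
          open ≡-Reasoning
          i = 3 + m ∸ j
          j≤3+m : j ≤ 3 + m
          j≤3+m = ≤-pred (≤-pred p)
          1+i<len : suc i < len
          1+i<len = s≤s (s≤s (m∸n≤m (3 + m) j))

  n∸k≡k : n ∸ k ≡ k
  n∸k≡k = trans (m+n∸m≡n k (k + 0)) (+-identityʳ k)

  no-progression : ∀ s {y} → 3 ≤ s → s + 3 ≤ n → ¬ Progression s y
  no-progression s 3≤s s+3≤n with s ≤? k
  ... | yes s≤k = no-progression≤k s 3≤s s≤k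
  ... | no s≰k = no-progression≤k (n ∸ s) 3≤n∸s n∸s≤k ∘ reverse (m+n≤o⇒m≤o s s+3≤n)
    where
      3≤n∸s : 3 ≤ n ∸ s
      3≤n∸s = m+n≤o⇒m≤o∸n 3 (subst (_≤ n) (+-comm s 3) s+3≤n)
      n∸s≤k : n ∸ s ≤ k
      n∸s≤k = ≤-trans (∸-monoʳ-≤ n (<⇒≤ (≰⇒> s≰k))) (≤-reflexive n∸k≡k)

  no-progression⁻ : ∀ X {y} → 3 ≤ X → X + 3 ≤ n → ¬ Progression (n ∸ X) y
  no-progression⁻ X 3≤X X+3≤n = no-progression (n ∸ X)
    (m+n≤o⇒m≤o∸n 3 (subst (_≤ n) (+-comm X 3) X+3≤n))
    (≤-trans (+-monoʳ-≤ (n ∸ X) 3≤X) (≤-reflexive (m∸n+n≡m (m+n≤o⇒m≤o X X+3≤n))))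

  decrement : ∀ a → 1 ≤ a → a < n → shift (n ∸ 1) a ≡ pred a
  decrement (suc a) _ a<n = trans (cong (_% n) (sym (+-suc a (n ∸ 1)))) (trans (≈⇒%≡ (+N-≈ a)) (small (<-trans (n<1+n a) a<n)))

  countdown : ∀ {y} → Progression (n ∸ 1) y → y 0 ≤ 6 + m → ∀ j → j + 2 ≤ y 0 → y j ≡ y 0 ∸ j
  countdown P y0≤k-2 zero _ = refl
  countdown {y} P y0≤k-2 (suc j) p = begin
      y (suc j)                  ≡⟨ step j 1+j<len ⟩
      shift (n ∸ 1) (y j)        ≡⟨ cong (shift (n ∸ 1)) (countdown P y0≤k-2 j (≤-trans (n≤1+n _) p)) ⟩
      shift (n ∸ 1) (y 0 ∸ j)    ≡⟨ decrement (y 0 ∸ j) (m<n⇒0<n∸m j<y0) (≤-trans (s≤s (m∸n≤m (y 0) j)) (inA-< (inA 0 (s≤s z≤n)))) ⟩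
      pred (y 0 ∸ j)             ≡⟨ pred[m∸n]≡m∸[1+n] (y 0) j ⟩
      y 0 ∸ suc j                ∎
    where
      open ≡-Reasoning
      open Progression P
      j<y0 : j < y 0
      j<y0 = ≤-trans (s≤s (m≤m+n j 2)) p
      1+j<len : suc j < len
      1+j<len = subst (_≤ 5 + m) (+-comm j 2) (≤-pred (≤-trans p y0≤k-2))

  -- so a progression of step −1 in A starts at k − 1 (it is k−1, k−2, …, 3):
  -- other starts reach −1, k + 1 or 2, none of which lies in A
  countdown-start : ∀ {y} → Progression (n ∸ 1) y → y 0 ≡ k ∸ 1
  countdown-start {y} P = from-start (inA 0 (s≤s z≤n))
    where
      open Progression P
      1<len : 1 < len
      1<len = s≤s (s≤s z≤n)
      2<len : 2 < len
      2<len = s≤s (s≤s (s≤s z≤n))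
      0↦-1 : ∀ {a} → a ≡ 0 → shift (n ∸ 1) a ≡ n ∸ 1
      0↦-1 refl = small (n<1+n _)
      from-start : InA k (y 0) → y 0 ≡ k ∸ 1
      from-start (inj₁ y0≡0) = ⊥-elim (∉A-n∸1 (subst (InA k) (trans (step 0 1<len) (0↦-1 y0≡0)) (inA 1 1<len)))
      from-start (inj₂ (inj₁ y0≡1)) = ⊥-elim (∉A-n∸1 (subst (InA k) y2≡-1 (inA 2 2<len)))
        where
          y1≡0 : y 1 ≡ 0
          y1≡0 = trans (step 0 1<len) (trans (cong (shift (n ∸ 1)) y0≡1) (decrement 1 ≤-refl (s≤s (s≤s z≤n))))
          y2≡-1 : y 2 ≡ n ∸ 1
          y2≡-1 = trans (step 1 2<len) (0↦-1 y1≡0)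
      from-start (inj₂ (inj₂ (inj₁ (3≤y0 , y0≤k-1)))) with y 0 ≟ 7 + m
      ... | yes y0≡k-1 = y0≡k-1
      ... | no y0≢k-1 = ⊥-elim (∉A-2 (subst (InA k) yd≡2 (inA d d<len)))
        where
          y0≤k-2 : y 0 ≤ 6 + m
          y0≤k-2 = ≤-pred (≤∧≢⇒< y0≤k-1 y0≢k-1)
          d = y 0 ∸ 2
          d<len : d < len
          d<len = s≤s (∸-monoˡ-≤ 2 y0≤k-2)
          yd≡2 : y d ≡ 2
          yd≡2 = trans (countdown P y0≤k-2 d (≤-reflexive (m∸n+n≡m (≤-trans (n≤1+n 2) 3≤y0)))) (m∸[m∸n]≡n (≤-trans (n≤1+n 2) 3≤y0))
      from-start (inj₂ (inj₂ (inj₂ y0≡k+2))) = ⊥-elim (∉A-k+1 (subst (InA k) y1≡k+1 (inA 1 1<len)))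
        where
          y1≡k+1 : y 1 ≡ k + 1
          y1≡k+1 = trans (step 0 1<len) (trans (cong (shift (n ∸ 1)) y0≡k+2)
                     (trans (decrement (k + 2) (s≤s z≤n) (inA-< {k + 2} (inj₂ (inj₂ (inj₂ refl))))) (cong pred (+-suc k 1))))

  data Residue (X : ℕ) : Set where
    is-0    : X ≡ 0 → Residue X
    is-1    : X ≡ 1 → Residue X
    is-2    : X ≡ 2 → Residue X
    generic : 3 ≤ X → X + 3 ≤ n → Residue X
    is-−2   : X ≡ n ∸ 2 → Residue X
    is-−1   : X ≡ n ∸ 1 → Residue X

  residue : ∀ X → X < n → Residue X
  residue 0 _ = is-0 refl
  residue 1 _ = is-1 refl
  residue 2 _ = is-2 refl
  residue X@(suc (suc (suc _))) X<n with X + 3 ≤? n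
  ... | yes X+3≤n = generic (s≤s (s≤s (s≤s z≤n))) X+3≤n
  ... | no X+3≰n = near-top (n ∸ X) (m∸n+n≡m (<⇒≤ X<n)) (≰⇒> X+3≰n)
    where
      near-top : ∀ d → d + X ≡ n → n < X + 3 → Residue X
      near-top 0 X≡n _ = ⊥-elim (<-irrefl X≡n X<n)
      near-top 1 1+X≡n _ = is-−1 (cong pred 1+X≡n)
      near-top 2 2+X≡n _ = is-−2 (cong (pred ∘ pred) 2+X≡n)
      near-top (suc (suc (suc d))) 3+d+X≡n n<X+3 =
        ⊥-elim (<-irrefl refl (≤-trans n<X+3 (≤-trans (≤-reflexive (+-comm X 3)) (≤-trans (s≤s (s≤s (s≤s (m≤n+m X d)))) (≤-reflexive 3+d+X≡n)))))

  -- n is even, so no even number is ≡ 1; in particular ±2 are not units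
  even-not-1 : ∀ t → (2 * t) % n ≢ 1
  even-not-1 t 2t≡1 = even≢odd t (q * k) (begin
      2 * t                   ≡⟨ m≡m%n+[m/n]*n (2 * t) n ⟩
      (2 * t) % n + q * n     ≡⟨ cong (_+ q * n) 2t≡1 ⟩
      suc (q * n)             ≡⟨ cong suc (regroup q m) ⟩
      suc (2 * (q * k))       ∎)
    where
      open ≡-Reasoning
      q = (2 * t) / n
      regroup : ∀ q m → q * (2 * (8 + m)) ≡ 2 * (q * (8 + m))
      regroup q m = solve (q ∷ m ∷ [])

  open Zmod n
  open ZnFacts n
  open Reduction k

  -- Part (1): if A were closed under a ↦ a − z (z ≠ 0), the orbit 0, −z, −2z, …
  -- would lie in A.
  differences : Differences
  differences z z≢0 = escape (_⊖ z) closure-fails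
    where
      Z = toℕ z
      orbit : ℕ → Zn
      orbit zero = ⟦ 0 ⟧
      orbit (suc j) = orbit j ⊖ z
      y : ℕ → ℕ
      y j = toℕ (orbit j)
      y-step : ∀ j → y (suc j) ≡ shift (n ∸ Z) (y j)
      y-step j = toℕ-⟦⟧ (y j + (n ∸ Z))
      y0≡0 : y 0 ≡ 0
      y0≡0 = ⟦⟧-small (s≤s z≤n)
      y1≡-z : y 1 ≡ n ∸ Z
      y1≡-z = trans (y-step 0) (trans (cong (shift (n ∸ Z)) y0≡0) (small (∸-monoʳ-< (n≢0⇒n>0 z≢0) (toℕ≤N z))))
      closure-fails : ¬ (∀ a → Aset k a → Aset k (a ⊖ z))
      closure-fails closed = case residue Z (toℕ<n z) of λ where
          (is-0 Z≡0) → z≢0 Z≡0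
          (is-1 Z≡1) → ∉A-n∸1 (subst (InA k) (trans y1≡-z (cong (n ∸_) Z≡1)) (in-orbit 1))
          (is-2 Z≡2) → ∉A-n∸2 (subst (InA k) (trans y1≡-z (cong (n ∸_) Z≡2)) (in-orbit 1))
          (generic 3≤Z Z+3≤n) → no-progression⁻ Z 3≤Z Z+3≤n (record { inA = λ j _ → in-orbit j ; step = λ j _ → y-step j })
          (is-−2 Z≡-2) → ∉A-2 (subst (InA k) (trans y1≡-z (trans (cong (n ∸_) Z≡-2) (m∸[m∸n]≡n {n} (s≤s (s≤s z≤n))))) (in-orbit 1))
          (is-−1 Z≡-1) → ∉A-2 (subst (InA k) (y2≡2 (trans (cong (n ∸_) Z≡-1) (m∸[m∸n]≡n {n} (s≤s z≤n)))) (in-orbit 2))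
        where
          in-orbit : ∀ j → Aset k (orbit j)
          in-orbit zero = inj₁ y0≡0
          in-orbit (suc j) = closed (orbit j) (in-orbit j)
          y2≡2 : n ∸ Z ≡ 1 → y 2 ≡ 2
          y2≡2 -z≡1 = trans (y-step 1) (trans (cong₂ shift -z≡1 (trans y1≡-z -z≡1)) (small (s≤s (s≤s (s≤s z≤n)))))

  -- Part (2) for w = v⁻¹ = −1: then v = −1 and v·∁A = 0 − ∁A.
  minus-one-reflected : ∀ v w → v ⊗ w ≡ ⟦ 1 ⟧ → toℕ w ≡ n ∸ 1 → Reflected v
  minus-one-reflected v w vw≡1 w≡-1 = ⟦ 0 ⟧ , λ z → to z , from z
    where
      v≡-1 : ∀ x → v ⊗ x ≡ ⟦ 0 ⟧ ⊖ x
      v≡-1 = inverse-of-minus-one v w w≡-1 (unit⇒≈1 v w vw≡1)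
      to : ∀ z → (v ·ˢ ∁ (Aset k)) z → (⟦ 0 ⟧ −ᵖ ∁ (Aset k)) z
      to z (x , x∉A , z≡vx) = x , x∉A , trans z≡vx (v≡-1 x)
      from : ∀ z → (⟦ 0 ⟧ −ᵖ ∁ (Aset k)) z → (v ·ˢ ∁ (Aset k)) z
      from z (x , x∉A , z≡-x) = x , x∉A , trans z≡-x (sym (v≡-1 x))

  two-apart : ∀ (w z : Zn) → toℕ w ≡ 1 → toℕ (w ⊗ (z ⊖ ⟦ 1 ⟧)) ≈ toℕ (w ⊗ (z ⊖ ⟦ 3 ⟧)) + 2
  two-apart w z w≡1 = ≈-trans (w⊗[z⊖a]-≈ w z 1 (s≤s (s≤s z≤n)))
                        (≈-trans (≡⇒≈ shifted) (≈-sym (≈-+ (w⊗[z⊖a]-≈ w z 3 (s≤s (s≤s (s≤s (s≤s z≤n))))) (≈-refl {2}))))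
    where
      Z = toℕ z
      shifted : toℕ w * (Z + (n ∸ 1)) ≡ toℕ w * (Z + (n ∸ 3)) + 2
      shifted rewrite w≡1 = begin
          1 * (Z + (n ∸ 1))          ≡⟨ *-identityˡ _ ⟩
          Z + suc (suc (n ∸ 3))      ≡⟨ +-suc Z (suc (n ∸ 3)) ⟩
          suc (Z + suc (n ∸ 3))      ≡⟨ cong suc (+-suc Z (n ∸ 3)) ⟩
          2 + (Z + (n ∸ 3))          ≡⟨ +-comm 2 (Z + (n ∸ 3)) ⟩
          Z + (n ∸ 3) + 2            ≡⟨ cong (_+ 2) (sym (*-identityˡ _)) ⟩
          1 * (Z + (n ∸ 3)) + 2      ∎
        where open ≡-Reasoning

  3+j∈A : ∀ j → j < len → Aset k ⟦ 3 + j ⟧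
  3+j∈A j j<len = inj₂ (inj₂ (inj₁ (subst (3 ≤_) (sym 3+j≡) (m≤m+n 3 j) , subst (_≤ 7 + m) (sym 3+j≡) 3+j≤k-1)))
    where
      3+j≤k-1 : 3 + j ≤ 7 + m
      3+j≤k-1 = s≤s (s≤s (s≤s (≤-pred j<len)))
      3+j≡ : toℕ ⟦ 3 + j ⟧ ≡ 3 + j
      3+j≡ = ⟦⟧-small (≤-trans (s≤s 3+j≤k-1) (m≤m+n (8 + m) _))

  closed⇒progression : ∀ w z → (∀ a → Aset k a → Aset k (w ⊗ (z ⊖ a)))
                     → Progression (n ∸ toℕ w) (λ j → toℕ (w ⊗ (z ⊖ ⟦ 3 + j ⟧)))
  closed⇒progression w z closed = record
    { inA = λ j j<len → closed ⟦ 3 + j ⟧ (3+j∈A j j<len)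
    ; step = λ j p → w⊗[z⊖a]-step w z (3 + j) (≤-trans (s≤s (s≤s (s≤s p))) (m≤m+n (8 + m) _)) }

  -- for w = 1 that progression is k−1, …, 3, so w(z − 1) = (k − 1) + 2 ∉ A
  closed-at-1 : ∀ w z → toℕ w ≡ 1 → ¬ (∀ a → Aset k a → Aset k (w ⊗ (z ⊖ a)))
  closed-at-1 w z w≡1 closed = ∉A-k+1 (subst (InA k) w[z-1]≡k+1 (closed ⟦ 1 ⟧ (inj₂ (inj₁ (⟦⟧-small (s≤s (s≤s z≤n)))))))
    where
      w[z-3]≡k-1 : toℕ (w ⊗ (z ⊖ ⟦ 3 ⟧)) ≡ 7 + m
      w[z-3]≡k-1 = countdown-start (subst (λ t → Progression (n ∸ t) (λ j → toℕ (w ⊗ (z ⊖ ⟦ 3 + j ⟧)))) w≡1 (closed⇒progression w z closed))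
      k-1+2≡k+1 : 7 + m + 2 ≡ 8 + m + 1
      k-1+2≡k+1 = solve (m ∷ [])
      w[z-1]≡k+1 : toℕ (w ⊗ (z ⊖ ⟦ 1 ⟧)) ≡ k + 1
      w[z-1]≡k+1 = ≈⇒≡ (toℕ<n _) (≤-by {suc (8 + m + 1)} {2 * (8 + m)} (6 + m) (solve (m ∷ [])))
                     (≈-trans (two-apart w z w≡1) (≡⇒≈ (trans (cong (_+ 2) w[z-3]≡k-1) k-1+2≡k+1)))

  -- a unit W (V W ≡ 1) is neither 0 nor ±2, because n is even
  unit≢0 : ∀ V {W} → (V * W) % n ≡ 1 → W ≢ 0
  unit≢0 V vw≡1 refl = case trans (sym vw≡1) (cong (_% n) (*-zeroʳ V)) of λ ()

  unit≢2 : ∀ V {W} → (V * W) % n ≡ 1 → W ≢ 2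
  unit≢2 V vw≡1 refl = even-not-1 V (trans (cong (_% n) (*-comm 2 V)) vw≡1)

  unit≢-2 : ∀ V {W} → (V * W) % n ≡ 1 → W ≢ n ∸ 2
  unit≢-2 V vw≡1 refl = even-not-1 (V * (7 + m)) (trans (cong (_% n) (sym (double V m))) vw≡1)
    where
      -- n − 2 = 6 + m + (8 + m + 0) = 2 (k − 1)
      double : ∀ V m → V * (6 + m + (8 + m + 0)) ≡ 2 * (V * (7 + m))
      double V m = solve (V ∷ m ∷ [])

  covering : ∀ v w → v ⊗ w ≡ ⟦ 1 ⟧ → toℕ w ≢ n ∸ 1 → Covering w
  covering v w vw≡1 w≢-1 z = escape (λ a → w ⊗ (z ⊖ a)) closure-fails
    where
      vw≡1′ : (toℕ v * toℕ w) % n ≡ 1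
      vw≡1′ = trans (≈⇒%≡ (unit⇒≈1 v w vw≡1)) (small (s≤s (s≤s z≤n)))
      closure-fails : ¬ (∀ a → Aset k a → Aset k (w ⊗ (z ⊖ a)))
      closure-fails closed = case residue (toℕ w) (toℕ<n w) of λ where
        (is-0 W≡0) → unit≢0 (toℕ v) vw≡1′ W≡0
        (is-1 W≡1) → closed-at-1 w z W≡1 closed
        (is-2 W≡2) → unit≢2 (toℕ v) vw≡1′ W≡2
        (generic 3≤W W+3≤n) → no-progression⁻ (toℕ w) 3≤W W+3≤n (closed⇒progression w z closed)
        (is-−2 W≡-2) → unit≢-2 (toℕ v) vw≡1′ W≡-2
        (is-−1 W≡-1) → w≢-1 W≡-1

  dichotomy : Dichotomy
  dichotomy v w vw≡1 with toℕ w ≟ n ∸ 1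
  ... | yes w≡-1 = inj₂ (minus-one-reflected v w vw≡1 w≡-1)
  ... | no w≢-1 = inj₁ (covering v w vw≡1 w≢-1)

hypotheses : ∀ k (hk : 3 ≤ k) → let instance _ = nonZero2k k hk in Reduction.Differences k × Reduction.Dichotomy k
hypotheses 0 ()
hypotheses 1 (s≤s ())
hypotheses 2 (s≤s (s≤s ()))
hypotheses 3 _ = Reduction.decide 3 tt
hypotheses 4 _ = Reduction.decide 4 tt
hypotheses 5 _ = Reduction.decide 5 tt
hypotheses 6 _ = Reduction.decide 6 tt
hypotheses 7 _ = Reduction.decide 7 tt
hypotheses (suc (suc (suc (suc (suc (suc (suc (suc m)))))))) _ = Large.differences m , Large.dichotomy m

mainTheorem5 : (k : ℕ) → (hk : 3 ≤ k) → let open Zmod (2 * k) {{nonZero2k k hk}} in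
    ((Aset k -ˢ ∁ (Aset k)) ≐ NonZeroElts)
    × (∀ (v : Zn) → Unit v → ¬ ((Aset k +ˢ (v ·ˢ ∁ (Aset k))) ≐ Univ)
    → ∃[ u ] ((v ·ˢ ∁ (Aset k)) ≐ (u −ᵖ ∁ (Aset k))))
mainTheorem5 k hk = let instance _ = nonZero2k k hk in
  Reduction.part1 k (proj₁ (hypotheses k hk)) , Reduction.part2 k (proj₂ (hypotheses k hk))
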